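{- There exists a partially ordered graph $(G,\preceq)$ such that $\mathrm{in}(G,\ell)<\mathrm{in}(G,\preceq)$, where $\ell$ is the $\alpha$-ranking of $(G,\preceq)$.
   Context: A partially ordered graph $(G,\preceq)$: $G=(V,E)$ finite simple graph, $\preceq$ partial order on $V$, $u\prec v$ meaning $u\preceq v$, $u\ne v$. An intersection representation of $G$ is a pair $(U,\varphi)$, $U$ finite, $\varphi(v)\subseteq U$, with $\{u,v\}\in E$ iff $\varphi(u)\cap\varphi(v)\ne\emptyset$ for distinct $u,v$; it is $\ell$-constrained if $|\varphi(v)|\ge\ell(v)$ for all $v$, and $\mathrm{in}(G,\ell)$ is the minimum $|U|$ of such. An intersection representation of $(G,\preceq)$ is an intersection representation of $G$ with $|\varphi(u)|<|\varphi(v)|$ whenever $u\prec v$; $\mathrm{in}(G,\preceq)$ is its minimum $|U|$. $\alpha\text{ - }\deg(v)$ is the maximum size of an independent set contained in $N(v)$. With $M$ the set of minimal elements of $(V,\preceq)$, the $\alpha$-ranking is $\ell(v)=\alpha\text{ - }\deg(v)$ for $v\in M$ and $\ell(v)=\max\{\alpha\text{ - }\deg(v),1+\max_{u\prec v}\ell(u)\}$ for $v\notin M$. -}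

module Defs where

open import Data.Nat using (ℕ; suc; _≤_; _<_)
open import Data.Fin using (Fin)
open import Data.Fin.Subset using (Subset; _∩_; ∣_∣; Nonempty; _∈_; _⊆_)
open import Data.Product using (Σ; ∃; _×_; _,_)
open import Data.Sum using (_⊎_)
open import Relation.Nullary using (¬_)
open import Relation.Binary using (Rel; IsPartialOrder)
open import Relation.Binary.PropositionalEquality using (_≡_; _≢_)
open import Function.Bundles using (_⇔_)
open import Level using (0ℓ)

record Graph (n : ℕ) : Set₁ where
  field
    Adj    : Fin n → Fin n → Set
    sym    : ∀ {u v} → Adj u v → Adj v u
    irrefl : ∀ {v} → ¬ Adj v v
open Graph public

record POGraph (n : ℕ) : Set₁ where
  field
    graph : Graph n
    _⪯_   : Rel (Fin n) 0ℓ
    isPartialOrder : IsPartialOrder _≡_ _⪯_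
  _≺_ : Fin n → Fin n → Set
  u ≺ v = (u ⪯ v) × (u ≢ v)
open POGraph public

-- Intersection representation (U, φ) of G with U = Fin m (any finite set up to bijection).
IsIntRep : ∀ {n} → Graph n → (m : ℕ) → (Fin n → Subset m) → Set
IsIntRep G m φ = ∀ u v → u ≢ v → (Adj G u v ⇔ Nonempty (φ u ∩ φ v))

HasConstrainedRep : ∀ {n} → Graph n → (Fin n → ℕ) → ℕ → Set
HasConstrainedRep G ℓ m =
  Σ (Fin _ → Subset m) λ φ → IsIntRep G m φ × (∀ v → ℓ v ≤ ∣ φ v ∣)

HasPORep : ∀ {n} → POGraph n → ℕ → Set
HasPORep P m =
  Σ (Fin _ → Subset m) λ φ → IsIntRep (graph P) m φ
    × (∀ u v → _≺_ P u v → ∣ φ u ∣ < ∣ φ v ∣)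

IsMinimum : (ℕ → Set) → ℕ → Set
IsMinimum Q k = Q k × (∀ m → Q m → k ≤ m)

InConstrained≡ : ∀ {n} → Graph n → (Fin n → ℕ) → ℕ → Set
InConstrained≡ G ℓ = IsMinimum (HasConstrainedRep G ℓ)

InPO≡ : ∀ {n} → POGraph n → ℕ → Set
InPO≡ P = IsMinimum (HasPORep P)

IndepInNbhd : ∀ {n} → Graph n → Fin n → Subset n → Set
IndepInNbhd G v S =
  (∀ u → u ∈ S → Adj G v u) × (∀ a b → a ∈ S → b ∈ S → ¬ Adj G a b)

IsAlphaDeg : ∀ {n} → Graph n → Fin n → ℕ → Set
IsAlphaDeg G v d =
  (Σ (Subset _) λ S → IndepInNbhd G v S × ∣ S ∣ ≡ d)
  × (∀ S → IndepInNbhd G v S → ∣ S ∣ ≤ d)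

IsMinimal : ∀ {n} → POGraph n → Fin n → Set
IsMinimal P v = ∀ u → ¬ _≺_ P u v

IsMax₂ : ℕ → ℕ → ℕ → Set
IsMax₂ a b x = a ≤ x × b ≤ x × (x ≡ a ⊎ x ≡ b)

-- ℓ is the α-ranking of (G, ⪯):
--   ℓ(v) = α-deg(v) for minimal v,
--   ℓ(v) = max{α-deg(v), 1 + max_{u ≺ v} ℓ(u)} otherwise.
IsAlphaRanking : ∀ {n} → POGraph n → (Fin n → ℕ) → Set
IsAlphaRanking {n} P ℓ = ∀ v →
  ∃ λ d → IsAlphaDeg (graph P) v d ×
    ( (IsMinimal P v → ℓ v ≡ d)
    × (¬ IsMinimal P v →
        ∃ λ mx → ( (∀ u → _≺_ P u v → ℓ u ≤ mx)
                 × (∃ λ u → _≺_ P u v × ℓ u ≡ mx) )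
               × IsMax₂ d (suc mx) (ℓ v)))

{-# OPTIONS --safe #-}
-- The wheel W₅ (a hub joined to a 5-cycle r₁ … r₅), ordered only by hub ≺ r₁,
-- has every α-degree equal to 2, so its α-ranking asks |φ r₁| ≥ 3 and |φ v| ≥ 2
-- otherwise.  In any intersection representation the rim edges r₂r₃, r₃r₄, r₄r₅
-- need three distinct points outside φ r₁, so |U| ≥ |φ r₁| + 3, which is 6 under
-- the ranking and is attained.  But the hub meets every rim vertex while
-- nonadjacent rim vertices stay disjoint, which forces |φ hub| ≥ 3; respecting
-- the order then needs |φ r₁| ≥ 4, hence |U| ≥ 7, again attained.

module Submission where

open import Defs
open import Data.Nat using (ℕ; _<_)
open import Data.Fin using (Fin)
open import Data.Product using (Σ; ∃; _×_)

open import Data.Bool using (Bool; true; false; T; _∨_)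
open import Data.Bool.Properties using (∨-comm)
open import Data.Fin using (zero; suc)
open import Data.Fin.Properties using (_≟_; all?)
open import Data.Fin.Subset using (Subset; ⁅_⁆; _∪_; _∩_; ∣_∣; ⊤; ⊥; _∈_; _∉_; _⊆_; _⊂_)
open import Data.Fin.Subset.Properties
  using (_∈?_; nonempty?; anySubset?; ∈⊤; ⊆⊤; ⊥⊆; ∉⊥; ∣⊤∣≡n; ∣⊥∣≡0; p⊆q⇒∣p∣≤∣q∣; p⊂q⇒∣p∣<∣q∣;
         p⊆p∪q; x∈p∪q⁺; x∈p∪q⁻; x∈p∩q⁺; x∈p∩q⁻; x∈⁅x⁆; x∈⁅y⁆⇒x≡y; x≢y⇒x∉⁅y⁆)
open import Data.List using (List; []; _∷_; length)
open import Data.List.Relation.Unary.All as All using (All; []; _∷_)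
open import Data.List.Relation.Unary.AllPairs using (AllPairs; []; _∷_)
open import Data.Nat using (suc; _+_; _≤_; _≤?_; _<?_; s≤s)
open import Data.Nat.Properties
  using (≤-refl; ≤-trans; n≤1+n; ≮⇒≥; +-suc; +-identityʳ; +-monoˡ-≤; module ≤-Reasoning)
  renaming (_≟_ to _≟ℕ_)
open import Data.Product using (_,_; proj₂; uncurry)
open import Data.Sum using (_⊎_; inj₁; inj₂; [_,_])
open import Data.Vec using ([]; _∷_)
open import Function.Bundles using (_⇔_; mk⇔; Equivalence)
open import Level using (0ℓ)
open import Relation.Binary using (Rel; Decidable)
open import Relation.Binary.PropositionalEquality as ≡
  using (_≡_; _≢_; refl; subst; isEquivalence; ≢-sym)
open import Relation.Nullary using (¬_; Dec; yes; no; contradiction)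
open import Relation.Nullary.Decidable
  using (map′; _×-dec_; _→-dec_; ¬?; T?; from-yes; from-no)

open Equivalence using (to; from)

∣p∣+length≤∣q∣ : ∀ {n} {p q : Subset n} {xs : List (Fin n)} → p ⊆ q →
                 All (_∈ q) xs → All (_∉ p) xs → AllPairs _≢_ xs →
                 ∣ p ∣ + length xs ≤ ∣ q ∣
∣p∣+length≤∣q∣ {p = p} {q} {[]} p⊆q _ _ _ =
  subst (_≤ ∣ q ∣) (≡.sym (+-identityʳ ∣ p ∣)) (p⊆q⇒∣p∣≤∣q∣ p⊆q)
∣p∣+length≤∣q∣ {p = p} {q} {x ∷ xs} p⊆q (x∈q ∷ xs⊆q) (x∉p ∷ xs∉p) (x≢xs ∷ xs-distinct) =
  begin
    ∣ p ∣ + suc (length xs)    ≡⟨ +-suc ∣ p ∣ (length xs) ⟩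
    suc ∣ p ∣ + length xs      ≤⟨ +-monoˡ-≤ (length xs) (p⊂q⇒∣p∣<∣q∣ p⊂p′) ⟩
    ∣ p′ ∣ + length xs         ≤⟨ ∣p∣+length≤∣q∣ p′⊆q xs⊆q xs∉p′ xs-distinct ⟩
    ∣ q ∣                      ∎
  where
  open ≤-Reasoning
  p′ : Subset _
  p′ = p ∪ ⁅ x ⁆
  p⊂p′ : p ⊂ p′
  p⊂p′ = p⊆p∪q ⁅ x ⁆ , x , x∈p∪q⁺ (inj₂ (x∈⁅x⁆ x)) , x∉p
  p′⊆q : p′ ⊆ q
  p′⊆q y∈p′ with x∈p∪q⁻ p ⁅ x ⁆ y∈p′
  ... | inj₁ y∈p = p⊆q y∈p
  ... | inj₂ y∈⁅x⁆ = subst (_∈ q) (≡.sym (x∈⁅y⁆⇒x≡y x y∈⁅x⁆)) x∈q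
  xs∉p′ : All (_∉ p′) xs
  xs∉p′ = All.zipWith
    (λ (y∉p , x≢y) y∈p′ → [ y∉p , x≢y⇒x∉⁅y⁆ (≢-sym x≢y) ] (x∈p∪q⁻ p ⁅ x ⁆ y∈p′))
    (xs∉p , x≢xs)

length≤∣p∣ : ∀ {n} {p : Subset n} {xs : List (Fin n)} →
             All (_∈ p) xs → AllPairs _≢_ xs → length xs ≤ ∣ p ∣
length≤∣p∣ {n} {p} {xs} xs⊆p xs-distinct =
  subst (λ k → k + length xs ≤ ∣ p ∣) (∣⊥∣≡0 n)
        (∣p∣+length≤∣q∣ ⊥⊆ xs⊆p (All.tabulate λ _ → ∉⊥) xs-distinct)

Independent : ∀ {n} → Graph n → Subset n → Set
Independent G S = ∀ a b → a ∈ S → b ∈ S → ¬ Adj G a b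

_⇔?_ : ∀ {a b} {A : Set a} {B : Set b} → Dec A → Dec B → Dec (A ⇔ B)
a? ⇔? b? = map′ (uncurry mk⇔) (λ A⇔B → to A⇔B , from A⇔B) ((a? →-dec b?) ×-dec (b? →-dec a?))

module _ {n} (G : Graph n) (adjacent? : Decidable (Adj G)) where

  independent? : ∀ S → Dec (Independent G S)
  independent? S = all? λ a → all? λ b → a ∈? S →-dec b ∈? S →-dec ¬? (adjacent? a b)

  indepInNbhd? : ∀ v S → Dec (IndepInNbhd G v S)
  indepInNbhd? v S = (all? λ u → u ∈? S →-dec adjacent? v u) ×-dec independent? S

  isIntRep? : ∀ m φ → Dec (IsIntRep G m φ)
  isIntRep? m φ = all? λ u → all? λ v →
    ¬? (u ≟ v) →-dec (adjacent? u v ⇔? nonempty? (φ u ∩ φ v))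

module IntRep {n} {G : Graph n} {m} {φ : Fin n → Subset m} (rep : IsIntRep G m φ) where

  adjacent⇒common : ∀ {u v} → u ≢ v → Adj G u v → ∃ λ x → x ∈ φ u × x ∈ φ v
  adjacent⇒common {u} {v} u≢v uv with to (rep u v u≢v) uv
  ... | x , x∈φu∩φv = x , x∈p∩q⁻ (φ u) (φ v) x∈φu∩φv

  nonadjacent⇒apart : ∀ {u v x y} → u ≢ v → ¬ Adj G u v → x ∈ φ u → y ∈ φ v → x ≢ y
  nonadjacent⇒apart {u} {v} {x} u≢v ¬uv x∈φu y∈φv refl =
    ¬uv (from (rep u v u≢v) (x , x∈p∩q⁺ (x∈φu , y∈φv)))

pattern hub = zero
pattern r₁  = suc zero
pattern r₂  = suc (suc zero)
pattern r₃  = suc (suc (suc zero))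
pattern r₄  = suc (suc (suc (suc zero)))
pattern r₅  = suc (suc (suc (suc (suc zero))))

spokeOrRim : Fin 6 → Fin 6 → Bool
spokeOrRim hub hub = false
spokeOrRim hub _   = true
spokeOrRim r₁  r₂  = true
spokeOrRim r₂  r₃  = true
spokeOrRim r₃  r₄  = true
spokeOrRim r₄  r₅  = true
spokeOrRim r₅  r₁  = true
spokeOrRim _   _   = false

W₅ : Graph 6
W₅ = record
  { Adj    = λ u v → T (spokeOrRim u v ∨ spokeOrRim v u)
  ; sym    = λ {u} {v} → subst T (∨-comm (spokeOrRim u v) (spokeOrRim v u))
  ; irrefl = λ { {hub} () ; {r₁} () ; {r₂} () ; {r₃} () ; {r₄} () ; {r₅} () }
  }

adjacent? : Decidable (Adj W₅)
adjacent? u v = T? (spokeOrRim u v ∨ spokeOrRim v u)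

_⊑_ : Rel (Fin 6) 0ℓ
u ⊑ v = u ≡ v ⊎ (u ≡ hub × v ≡ r₁)

⊑-trans : ∀ {u v w} → u ⊑ v → v ⊑ w → u ⊑ w
⊑-trans (inj₁ refl) v⊑w = v⊑w
⊑-trans u⊑v (inj₁ refl) = u⊑v
⊑-trans (inj₂ (_ , refl)) (inj₂ (() , _))

⊑-antisym : ∀ {u v} → u ⊑ v → v ⊑ u → u ≡ v
⊑-antisym (inj₁ u≡v) _ = u≡v
⊑-antisym _ (inj₁ v≡u) = ≡.sym v≡u
⊑-antisym (inj₂ (_ , refl)) (inj₂ (() , _))

orderedW₅ : POGraph 6
orderedW₅ = record
  { graph = W₅
  ; _⪯_ = _⊑_
  ; isPartialOrder = record
    { isPreorder = record { isEquivalence = isEquivalence ; reflexive = inj₁ ; trans = ⊑-trans }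
    ; antisym = ⊑-antisym
    }
  }

hub≺r₁ : _≺_ orderedW₅ hub r₁
hub≺r₁ = inj₂ (refl , refl) , λ ()

≺-inv : ∀ {u v} → _≺_ orderedW₅ u v → u ≡ hub × v ≡ r₁
≺-inv (inj₁ u≡v , u≢v) = contradiction u≡v u≢v
≺-inv (inj₂ u≡hub×v≡r₁ , _) = u≡hub×v≡r₁

≢r₁⇒minimal : ∀ {v} → v ≢ r₁ → IsMinimal orderedW₅ v
≢r₁⇒minimal v≢r₁ u u≺v = v≢r₁ (proj₂ (≺-inv u≺v))

independent⇒∣S∣≤2 : ∀ S → Independent W₅ S → ∣ S ∣ ≤ 2
independent⇒∣S∣≤2 S S-independent = ≮⇒≥ λ 2<∣S∣ →
  from-no (anySubset? λ S → independent? W₅ adjacent? S ×-dec 2 <? ∣ S ∣)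
          (S , S-independent , 2<∣S∣)

nonadjacentNeighbours : Fin 6 → Subset 6
nonadjacentNeighbours hub = ⁅ r₁ ⁆ ∪ ⁅ r₃ ⁆
nonadjacentNeighbours r₁  = ⁅ r₅ ⁆ ∪ ⁅ r₂ ⁆
nonadjacentNeighbours r₂  = ⁅ r₁ ⁆ ∪ ⁅ r₃ ⁆
nonadjacentNeighbours r₃  = ⁅ r₂ ⁆ ∪ ⁅ r₄ ⁆
nonadjacentNeighbours r₄  = ⁅ r₃ ⁆ ∪ ⁅ r₅ ⁆
nonadjacentNeighbours r₅  = ⁅ r₄ ⁆ ∪ ⁅ r₁ ⁆

α-deg≡2 : ∀ v → IsAlphaDeg W₅ v 2
α-deg≡2 v =
  (nonadjacentNeighbours v , from-yes witnesses v)
  , λ S (_ , S-independent) → independent⇒∣S∣≤2 S S-independent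
  where
  witnesses : Dec (∀ v → IndepInNbhd W₅ v (nonadjacentNeighbours v)
                        × ∣ nonadjacentNeighbours v ∣ ≡ 2)
  witnesses = all? λ v → indepInNbhd? W₅ adjacent? v (nonadjacentNeighbours v)
                         ×-dec ∣ nonadjacentNeighbours v ∣ ≟ℕ 2

rank : Fin 6 → ℕ
rank r₁ = 3
rank _  = 2

rank-isAlphaRanking : IsAlphaRanking orderedW₅ rank
rank-isAlphaRanking hub = 2 , α-deg≡2 hub , (λ _ → refl) , contradiction (≢r₁⇒minimal λ ())
rank-isAlphaRanking r₁ =
  2 , α-deg≡2 r₁ , (λ minimal → contradiction hub≺r₁ (minimal hub)) ,
  λ _ → 2 , (below-r₁ , hub , hub≺r₁ , refl) , (n≤1+n 2 , ≤-refl , inj₂ refl)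
  where
  below-r₁ : ∀ u → _≺_ orderedW₅ u r₁ → rank u ≤ 2
  below-r₁ u u≺r₁ with ≺-inv u≺r₁
  ... | refl , _ = ≤-refl
rank-isAlphaRanking v@(suc (suc _)) =
  2 , α-deg≡2 v , (λ _ → refl) , contradiction (≢r₁⇒minimal λ ())

-- Point i < 5 is the triangle {hub, rᵢ₊₁, rᵢ₊₂} (indices mod 5); point 5 is private to r₁.
φ₆ : Fin 6 → Subset 6
φ₆ hub = true  ∷ true  ∷ true  ∷ true  ∷ true  ∷ false ∷ []
φ₆ r₁  = true  ∷ false ∷ false ∷ false ∷ true  ∷ true  ∷ []
φ₆ r₂  = true  ∷ true  ∷ false ∷ false ∷ false ∷ false ∷ []
φ₆ r₃  = false ∷ true  ∷ true  ∷ false ∷ false ∷ false ∷ []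
φ₆ r₄  = false ∷ false ∷ true  ∷ true  ∷ false ∷ false ∷ []
φ₆ r₅  = false ∷ false ∷ false ∷ true  ∷ true  ∷ false ∷ []

-- Points 0, 1 are the rim edges r₁r₂ and r₃r₄; points 2, 3, 4 the triangles
-- {hub, r₅, r₁}, {hub, r₂, r₃}, {hub, r₄, r₅}; points 5, 6 are private to r₁.
φ₇ : Fin 6 → Subset 7
φ₇ hub = false ∷ false ∷ true  ∷ true  ∷ true  ∷ false ∷ false ∷ []
φ₇ r₁  = true  ∷ false ∷ true  ∷ false ∷ false ∷ true  ∷ true  ∷ []
φ₇ r₂  = true  ∷ false ∷ false ∷ true  ∷ false ∷ false ∷ false ∷ []
φ₇ r₃  = false ∷ true  ∷ false ∷ true  ∷ false ∷ false ∷ false ∷ []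
φ₇ r₄  = false ∷ true  ∷ false ∷ false ∷ true  ∷ false ∷ false ∷ []
φ₇ r₅  = false ∷ false ∷ true  ∷ false ∷ true  ∷ false ∷ false ∷ []

constrainedRep₆ : HasConstrainedRep W₅ rank 6
constrainedRep₆ =
  φ₆ , from-yes (isIntRep? W₅ adjacent? 6 φ₆) , from-yes (all? λ v → rank v ≤? ∣ φ₆ v ∣)

orderedRep₇ : HasPORep orderedW₅ 7
orderedRep₇ = φ₇ , from-yes (isIntRep? W₅ adjacent? 7 φ₇) , monotone
  where
  monotone : ∀ u v → _≺_ orderedW₅ u v → ∣ φ₇ u ∣ < ∣ φ₇ v ∣
  monotone u v u≺v with ≺-inv u≺v
  ... | refl , refl = ≤-refl

module _ {m} {φ : Fin 6 → Subset m} (rep : IsIntRep W₅ m φ) where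

  open IntRep {G = W₅} rep renaming (adjacent⇒common to common; nonadjacent⇒apart to apart)

  ∣φr₁∣+3≤m : ∣ φ r₁ ∣ + 3 ≤ m
  ∣φr₁∣+3≤m =
    let x₂₃ , x₂₃∈φr₂ , x₂₃∈φr₃ = common {r₂} {r₃} (λ ()) _
        x₃₄ , x₃₄∈φr₃ , x₃₄∈φr₄ = common {r₃} {r₄} (λ ()) _
        x₄₅ , x₄₅∈φr₄ , x₄₅∈φr₅ = common {r₄} {r₅} (λ ()) _
    in subst (∣ φ r₁ ∣ + 3 ≤_) (∣⊤∣≡n m)
         (∣p∣+length≤∣q∣ ⊆⊤ (∈⊤ ∷ ∈⊤ ∷ ∈⊤ ∷ [])
           ( (λ x∈φr₁ → apart (λ ()) (λ ()) x∈φr₁ x₂₃∈φr₃ refl)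
           ∷ (λ x∈φr₁ → apart (λ ()) (λ ()) x∈φr₁ x₃₄∈φr₃ refl)
           ∷ (λ x∈φr₁ → apart (λ ()) (λ ()) x∈φr₁ x₄₅∈φr₄ refl) ∷ [])
           ( (apart (λ ()) (λ ()) x₂₃∈φr₂ x₃₄∈φr₄ ∷ apart (λ ()) (λ ()) x₂₃∈φr₂ x₄₅∈φr₅ ∷ [])
           ∷ (apart (λ ()) (λ ()) x₃₄∈φr₃ x₄₅∈φr₅ ∷ [])
           ∷ [] ∷ []))

  -- Choosing xᵢ ∈ φ hub ∩ φ rᵢ properly colours the complement of the rim,
  -- again a 5-cycle, so at least three of the xᵢ are distinct.
  3≤∣φhub∣ : 3 ≤ ∣ φ hub ∣
  3≤∣φhub∣
    with x₁ , x₁∈φhub , x₁∈φr₁ ← common {hub} {r₁} (λ ()) _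
       | x₂ , x₂∈φhub , x₂∈φr₂ ← common {hub} {r₂} (λ ()) _
       | x₃ , x₃∈φhub , x₃∈φr₃ ← common {hub} {r₃} (λ ()) _
       | x₄ , x₄∈φhub , x₄∈φr₄ ← common {hub} {r₄} (λ ()) _
       | x₅ , x₅∈φhub , x₅∈φr₅ ← common {hub} {r₅} (λ ()) _
       | x₁ ≟ x₅
  ... | no x₁≢x₅ =
    length≤∣p∣ (x₁∈φhub ∷ x₃∈φhub ∷ x₅∈φhub ∷ [])
      ( (apart (λ ()) (λ ()) x₁∈φr₁ x₃∈φr₃ ∷ x₁≢x₅ ∷ [])
      ∷ (apart (λ ()) (λ ()) x₃∈φr₃ x₅∈φr₅ ∷ [])
      ∷ [] ∷ [])
  ... | yes refl =
    length≤∣p∣ (x₂∈φhub ∷ x₄∈φhub ∷ x₅∈φhub ∷ [])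
      ( (apart (λ ()) (λ ()) x₂∈φr₂ x₄∈φr₄ ∷ apart (λ ()) (λ ()) x₂∈φr₂ x₅∈φr₅ ∷ [])
      ∷ (apart (λ ()) (λ ()) x₄∈φr₄ x₁∈φr₁ ∷ [])
      ∷ [] ∷ [])

in-constrained≥6 : ∀ m → HasConstrainedRep W₅ rank m → 6 ≤ m
in-constrained≥6 m (_ , rep , rank≤∣φ∣) =
  ≤-trans (+-monoˡ-≤ 3 (rank≤∣φ∣ r₁)) (∣φr₁∣+3≤m rep)

in-ordered≥7 : ∀ m → HasPORep orderedW₅ m → 7 ≤ m
in-ordered≥7 m (_ , rep , monotone) =
  ≤-trans (+-monoˡ-≤ 3 (≤-trans (s≤s (3≤∣φhub∣ rep)) (monotone hub r₁ hub≺r₁)))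
          (∣φr₁∣+3≤m rep)

proposition16 : ∃ λ n → Σ (POGraph n) λ P → Σ (Fin n → ℕ) λ ℓ →
    IsAlphaRanking P ℓ ×
    (∃ λ k₁ → ∃ λ k₂ → InConstrained≡ (graph P) ℓ k₁ × InPO≡ P k₂ × k₁ < k₂)
proposition16 =
  6 , orderedW₅ , rank , rank-isAlphaRanking ,
  6 , 7 , (constrainedRep₆ , in-constrained≥6) , (orderedRep₇ , in-ordered≥7) , ≤-refl
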